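{- Given a $k$-dominating set $D$ of a connected graph $G$ and a quadruple $u,v,x,y \in D$, then for each quadruple $u',v',x',y'$ with respective associated dominators $u,v,x,y$, we have $\delta(u',v',x',y') \leq \min_{a,b\in\{u,v,x,y\}}k_{a}+k_{b}+d(a, b) \leq 2k + \min_{a,b\in\{u,v,x,y\}}d(a, b)$. Furthermore, assuming that $S_1 = d(u,v) + d(x,y)$ is the largest of the three sums (which can be assumed w.l.o.g.), for each quadruple $u',v',x',y'$ with respective associated dominators $u,v,x,y$ we have $\delta(u',v',x',y')\leq k_{u}+k_{v} + k_{x}+k_{y} +\frac{1}{2}\min\{d(u,v), d(x,y)\} \leq 4k + \frac{1}{2}\min\{d(u,v), d(x,y)\}$ and $\tau(u',v',x',y') \leq\frac{1}{2}\min\{k_{u}+k_{v}+d(u,v), k_{x}+k_{y}+d(x,y)\} \leq k + \frac{1}{2}\min\{d(u,v), d(x,y)\}$.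
   Context: $G=(V,E)$ is a finite, connected, unweighted, simple graph and $d(u,v)$ denotes the shortest-path distance in $G$. A $k$-dominating set is a set $D\subseteq V$ such that every vertex is at distance at most $k$ from some vertex of $D$; each $v\in V$ has an associated dominator $D(v)\in D$ with $d(v,D(v))\le k$, $D^{ -1}(u)=\{v: D(v)=u\}$, and $k_u=\max_{v\in D^{ -1}(u)} d(u,v)$. For a quadruple $u,v,x,y$, $\delta(u,v,x,y)$ is half the difference between the two largest of the sums $S_1=d(u,v)+d(x,y)$, $S_2=d(u,x)+d(v,y)$, $S_3=d(u,y)+d(v,x)$, and $\tau(u,v,x,y)=\frac12\big(d(u,v)+d(x,y)-\max\{d(x,u)+d(y,v), d(x,v)+d(y,u)\}\big)$. -}

module Defs where

open import Data.Nat using (ℕ; zero; suc; _+_; _*_; _∸_; _≤_; _⊔_; _⊓_)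
open import Data.Fin using (Fin; _≟_)
open import Data.List using (List; foldr)
open import Data.List using (allFin)
open import Data.Product using (Σ; ∃; _×_)
open import Relation.Nullary using (¬_; does)
open import Relation.Binary.PropositionalEquality using (_≡_)
open import Data.Bool using (if_then_else_)

record Graph (n : ℕ) : Set₁ where
  field
    Adj     : Fin n → Fin n → Set
    sym     : ∀ {u v} → Adj u v → Adj v u
    irrefl  : ∀ {u} → ¬ Adj u u

open Graph public

data Walk {n : ℕ} (G : Graph n) : Fin n → Fin n → ℕ → Set where
  [] : ∀ {u} → Walk G u u 0
  _∷_ : ∀ {u w v ℓ} → Adj G u w → Walk G w v ℓ → Walk G u v (suc ℓ)

Connected : ∀ {n} → Graph n → Set
Connected G = ∀ u v → ∃ λ ℓ → Walk G u v ℓ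

IsShortestPathDistance : ∀ {n} → Graph n → (Fin n → Fin n → ℕ) → Set
IsShortestPathDistance G d =
  ∀ u v → Walk G u v (d u v) × (∀ ℓ → Walk G u v ℓ → d u v ≤ ℓ)

-- k_u = max_{v ∈ D⁻¹(u)} d(u,v)   (max of the empty set taken as 0)
kOf : ∀ {n} → (Fin n → Fin n → ℕ) → (Fin n → Fin n) → Fin n → ℕ
kOf {n} d Dom u =
  foldr (λ v acc → (if does (Dom v ≟ u) then d u v else 0) ⊔ acc) 0 (allFin n)

-- Largest and second largest of three numbers.
max3 : ℕ → ℕ → ℕ → ℕ
max3 a b c = a ⊔ b ⊔ c

mid3 : ℕ → ℕ → ℕ → ℕ
mid3 a b c = (a ⊓ b) ⊔ ((a ⊔ b) ⊓ c)

module _ {n : ℕ} (d : Fin n → Fin n → ℕ) where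

  S₁ S₂ S₃ : Fin n → Fin n → Fin n → Fin n → ℕ
  S₁ u v x y = d u v + d x y
  S₂ u v x y = d u x + d v y
  S₃ u v x y = d u y + d v x

  -- twiceδ = 2 · δ(u,v,x,y) = (largest sum) − (second largest sum)
  twiceδ : Fin n → Fin n → Fin n → Fin n → ℕ
  twiceδ u v x y = max3 (S₁ u v x y) (S₂ u v x y) (S₃ u v x y)
                 ∸ mid3 (S₁ u v x y) (S₂ u v x y) (S₃ u v x y)

  minPairs : (Fin n → Fin n → ℕ) → Fin n → Fin n → Fin n → Fin n → ℕ
  minPairs f u v x y = f u v ⊓ f u x ⊓ f u y ⊓ f v x ⊓ f v y ⊓ f x y

{-# OPTIONS --safe #-}
-- Only two facts about d are used: it is symmetric and satisfies the triangle
-- inequality. In such a space 2δ of a quadruple is at most twice the distance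
-- of any of its six pairs, and S₁ ≤ max(S₂, S₃) + min(d u v, d x y) always, which
-- bounds τ and, when S₁ is the largest sum, gives 2δ ≤ min(d u v, d x y).
-- The δ bounds rest on one criterion: the largest of three numbers exceeds the middle
-- one by at most m as soon as each is at most the larger of the other two plus m.
-- That criterion survives perturbation: moving each vertex to its dominator
-- changes every d a b by at most k_a + k_b, hence each of the three sums by at
-- most K = k_u + k_v + k_x + k_y, and the criterion then holds with 2K + m.
module Submission where

open import Defs hiding (sym)
open import Data.Nat using (ℕ; suc; _+_; _*_; _≤_; _⊔_; _⊓_; _∸_; z≤n)
open import Data.Nat.Properties hiding (_≟_)
open import Data.Nat.Tactic.RingSolver using (solve-∀)
open import Data.Fin using (Fin; _≟_)
open import Data.Product using (_×_; _,_; proj₁; proj₂)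
open import Data.List using ([]; _∷_; foldr; allFin)
open import Data.List.Membership.Propositional using (_∈_)
open import Data.List.Membership.Propositional.Properties using (∈-allFin)
open import Data.List.Relation.Unary.Any using (here; there)
open import Data.Bool using (if_then_else_)
open import Relation.Nullary using (yes; no; does; contradiction)
open import Relation.Binary.PropositionalEquality
  using (_≡_; refl; sym; trans; cong; cong₂; subst; subst₂; module ≡-Reasoning)

spread : ℕ → ℕ → ℕ → ℕ
spread a b c = max3 a b c ∸ mid3 a b c

spread-cong : ∀ {a a′ b b′ c c′} → a ≡ a′ → b ≡ b′ → c ≡ c′ →
  spread a b c ≡ spread a′ b′ c′
spread-cong refl refl refl = refl

mid3≡⊔-of-⊓ : ∀ a b c → mid3 a b c ≡ (a ⊓ b) ⊔ ((a ⊓ c) ⊔ (b ⊓ c))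
mid3≡⊔-of-⊓ a b c = cong ((a ⊓ b) ⊔_) (⊓-distribʳ-⊔ c a b)

mid3-swap₁₂ : ∀ a b c → mid3 a b c ≡ mid3 b a c
mid3-swap₁₂ a b c = cong₂ _⊔_ (⊓-comm a b) (cong (_⊓ c) (⊔-comm a b))

mid3-swap₂₃ : ∀ a b c → mid3 a b c ≡ mid3 a c b
mid3-swap₂₃ a b c = begin
  mid3 a b c                            ≡⟨ mid3≡⊔-of-⊓ a b c ⟩
  (a ⊓ b) ⊔ ((a ⊓ c) ⊔ (b ⊓ c))         ≡⟨ sym (⊔-assoc (a ⊓ b) (a ⊓ c) (b ⊓ c)) ⟩
  (a ⊓ b) ⊔ (a ⊓ c) ⊔ (b ⊓ c)           ≡⟨ cong₂ _⊔_ (⊔-comm (a ⊓ b) (a ⊓ c)) (⊓-comm b c) ⟩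
  (a ⊓ c) ⊔ (a ⊓ b) ⊔ (c ⊓ b)           ≡⟨ ⊔-assoc (a ⊓ c) (a ⊓ b) (c ⊓ b) ⟩
  (a ⊓ c) ⊔ ((a ⊓ b) ⊔ (c ⊓ b))         ≡⟨ sym (mid3≡⊔-of-⊓ a c b) ⟩
  mid3 a c b                            ∎
  where open ≡-Reasoning

max3-swap₂₃ : ∀ a b c → max3 a b c ≡ max3 a c b
max3-swap₂₃ a b c =
  trans (⊔-assoc a b c) (trans (cong (a ⊔_) (⊔-comm b c)) (sym (⊔-assoc a c b)))

spread-swap₁₂ : ∀ a b c → spread a b c ≡ spread b a c
spread-swap₁₂ a b c = cong₂ _∸_ (cong (_⊔ c) (⊔-comm a b)) (mid3-swap₁₂ a b c)

spread-swap₂₃ : ∀ a b c → spread a b c ≡ spread a c b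
spread-swap₂₃ a b c = cong₂ _∸_ (max3-swap₂₃ a b c) (mid3-swap₂₃ a b c)

x⊓[y⊔z]≤mid3 : ∀ x y z → x ⊓ (y ⊔ z) ≤ mid3 x y z
x⊓[y⊔z]≤mid3 x y z = begin
  x ⊓ (y ⊔ z)               ≡⟨ ⊓-distribˡ-⊔ x y z ⟩
  (x ⊓ y) ⊔ (x ⊓ z)         ≤⟨ ⊔-monoʳ-≤ (x ⊓ y) (⊓-monoˡ-≤ z (m≤m⊔n x y)) ⟩
  (x ⊓ y) ⊔ ((x ⊔ y) ⊓ z)   ∎
  where open ≤-Reasoning

x≤y+m⇒x≤x⊓y+m : ∀ {x y} m → x ≤ y + m → x ≤ (x ⊓ y) + m
x≤y+m⇒x≤x⊓y+m {x} {y} m x≤y+m =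
  subst (x ≤_) (sym (+-distribʳ-⊓ m x y)) (⊓-glb (m≤m+n x m) x≤y+m)

record Balanced (m a b c : ℕ) : Set where
  field
    first  : a ≤ (b ⊔ c) + m
    second : b ≤ (a ⊔ c) + m
    third  : c ≤ (a ⊔ b) + m

Balanced⇒spread≤ : ∀ {m a b c} → Balanced m a b c → spread a b c ≤ m
Balanced⇒spread≤ {m} {a} {b} {c} bal =
  m≤n+o⇒m∸n≤o (max3 a b c) (mid3 a b c) (⊔-lub (⊔-lub a≤ b≤) c≤)
  where
  open Balanced bal
  below-mid3 : ∀ {x y} → x ⊓ y ≤ mid3 a b c → x ≤ y + m → x ≤ mid3 a b c + m
  below-mid3 {x} {y} x⊓y≤ x≤y+m =
    ≤-trans (x≤y+m⇒x≤x⊓y+m m x≤y+m) (+-monoˡ-≤ m x⊓y≤)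
  a≤ : a ≤ mid3 a b c + m
  a≤ = below-mid3 (x⊓[y⊔z]≤mid3 a b c) first
  b≤ : b ≤ mid3 a b c + m
  b≤ = below-mid3 (subst (b ⊓ (a ⊔ c) ≤_) (sym (mid3-swap₁₂ a b c)) (x⊓[y⊔z]≤mid3 b a c)) second
  c≤ : c ≤ mid3 a b c + m
  c≤ = below-mid3
    (subst (c ⊓ (a ⊔ b) ≤_) (sym (trans (mid3-swap₂₃ a b c) (mid3-swap₁₂ a c b)))
      (x⊓[y⊔z]≤mid3 c a b))
    third

Balanced-fromMax : ∀ {m a b c} → b ≤ a → c ≤ a → a ≤ (b ⊔ c) + m → Balanced m a b c
Balanced-fromMax {m} {a} {b} {c} b≤a c≤a a≤ = record
  { first  = a≤
  ; second = ≤-trans b≤a (≤-trans (m≤m⊔n a c) (m≤m+n (a ⊔ c) m))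
  ; third  = ≤-trans c≤a (≤-trans (m≤m⊔n a b) (m≤m+n (a ⊔ b) m))
  }

Close : ℕ → ℕ → ℕ → Set
Close K a b = a ≤ b + K × b ≤ a + K

Close-+ : ∀ {K L a b c e} → Close K a b → Close L c e → Close (K + L) (a + c) (b + e)
Close-+ {K} {L} {a} {b} {c} {e} (a≤ , b≤) (c≤ , e≤) =
  ≤-trans (+-mono-≤ a≤ c≤) (≤-reflexive (interchange b K e L)) ,
  ≤-trans (+-mono-≤ b≤ e≤) (≤-reflexive (interchange a K c L))
  where
  interchange : ∀ w x y z → (w + x) + (y + z) ≡ (w + y) + (x + z)
  interchange = solve-∀

⊔-mono-≤-+ : ∀ {K a a′ b b′} → a ≤ a′ + K → b ≤ b′ + K → a ⊔ b ≤ (a′ ⊔ b′) + K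
⊔-mono-≤-+ {K} {a} {a′} {b} {b′} a≤ b≤ =
  subst (a ⊔ b ≤_) (sym (+-distribʳ-⊔ K a′ b′)) (⊔-mono-≤ a≤ b≤)

Balanced-perturb : ∀ {K m a a′ b b′ c c′} →
  Close K a a′ → Close K b b′ → Close K c c′ →
  Balanced m a b c → Balanced (2 * K + m) a′ b′ c′
Balanced-perturb {K} {m} {a′ = a′} {b′ = b′} {c′ = c′} ca cb cc bal = record
  { first  = moved (proj₂ ca) first  (⊔-mono-≤-+ {a′ = b′} {b′ = c′} (proj₁ cb) (proj₁ cc))
  ; second = moved (proj₂ cb) second (⊔-mono-≤-+ {a′ = a′} {b′ = c′} (proj₁ ca) (proj₁ cc))
  ; third  = moved (proj₂ cc) third  (⊔-mono-≤-+ {a′ = a′} {b′ = b′} (proj₁ ca) (proj₁ cb))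
  }
  where
  open Balanced bal
  regroup : ∀ y K m → y + K + m + K ≡ y + (2 * K + m)
  regroup = solve-∀
  moved : ∀ {x x′ y y′} → x′ ≤ x + K → x ≤ y + m → y ≤ y′ + K → x′ ≤ y′ + (2 * K + m)
  moved {y′ = y′} x′≤ x≤ y≤ = begin
    _                  ≤⟨ x′≤ ⟩
    _ + K              ≤⟨ +-monoˡ-≤ K (≤-trans x≤ (+-monoˡ-≤ m y≤)) ⟩
    y′ + K + m + K     ≡⟨ regroup y′ K m ⟩
    y′ + (2 * K + m)   ∎
    where open ≤-Reasoning

2*x≤y+z+2*t⇒x≤y⊔z+t : ∀ x y z t → 2 * x ≤ (y + z) + 2 * t → x ≤ (y ⊔ z) + t
2*x≤y+z+2*t⇒x≤y⊔z+t x y z t h = *-cancelˡ-≤ 2 (begin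
  2 * x                        ≤⟨ h ⟩
  (y + z) + 2 * t              ≤⟨ +-monoˡ-≤ (2 * t) (+-mono-≤ (m≤m⊔n y z) (m≤n⊔m y z)) ⟩
  ((y ⊔ z) + (y ⊔ z)) + 2 * t  ≡⟨ double (y ⊔ z) t ⟩
  2 * ((y ⊔ z) + t)            ∎)
  where
  open ≤-Reasoning
  double : ∀ w t → (w + w) + 2 * t ≡ 2 * (w + t)
  double = solve-∀

+-⊓-glb : ∀ {x y t₁ t₂} → x ≤ y + t₁ → x ≤ y + t₂ → x ≤ y + (t₁ ⊓ t₂)
+-⊓-glb {x} {y} {t₁} {t₂} h₁ h₂ = subst (x ≤_) (sym (+-distribˡ-⊓ y t₁ t₂)) (⊓-glb h₁ h₂)

module _ {n} (d : Fin n → Fin n → ℕ) where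

  minPairs-mono : ∀ {f g : Fin n → Fin n → ℕ} → (∀ a b → f a b ≤ g a b) →
    ∀ u v x y → minPairs d f u v x y ≤ minPairs d g u v x y
  minPairs-mono f≤g u v x y =
    ⊓-mono-≤ (⊓-mono-≤ (⊓-mono-≤ (⊓-mono-≤ (⊓-mono-≤ (f≤g u v) (f≤g u x))
      (f≤g u y)) (f≤g v x)) (f≤g v y)) (f≤g x y)

  minPairs-glb : ∀ {t} (f : Fin n → Fin n → ℕ) u v x y →
    t ≤ f u v → t ≤ f u x → t ≤ f u y → t ≤ f v x → t ≤ f v y → t ≤ f x y →
    t ≤ minPairs d f u v x y
  minPairs-glb f u v x y ≤uv ≤ux ≤uy ≤vx ≤vy ≤xy =
    ⊓-glb (⊓-glb (⊓-glb (⊓-glb (⊓-glb ≤uv ≤ux) ≤uy) ≤vx) ≤vy) ≤xy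

  minPairs-homo : ∀ (h : ℕ → ℕ) → (∀ {a b} → a ≤ b → h a ≤ h b) →
    ∀ (f : Fin n → Fin n → ℕ) u v x y →
    h (minPairs d f u v x y) ≡ minPairs d (λ a b → h (f a b)) u v x y
  minPairs-homo h mono f u v x y
    rewrite mono-≤-distrib-⊓ mono (f u v ⊓ f u x ⊓ f u y ⊓ f v x ⊓ f v y) (f x y)
          | mono-≤-distrib-⊓ mono (f u v ⊓ f u x ⊓ f u y ⊓ f v x) (f v y)
          | mono-≤-distrib-⊓ mono (f u v ⊓ f u x ⊓ f u y) (f v x)
          | mono-≤-distrib-⊓ mono (f u v ⊓ f u x) (f u y)
          | mono-≤-distrib-⊓ mono (f u v) (f u x) = refl

module _ {A : Set} (g : A → ℕ) where

  foldr-⊔-≥ : ∀ {w xs} → w ∈ xs → g w ≤ foldr (λ v acc → g v ⊔ acc) 0 xs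
  foldr-⊔-≥ (here refl) = m≤m⊔n _ _
  foldr-⊔-≥ (there w∈xs) = ≤-trans (foldr-⊔-≥ w∈xs) (m≤n⊔m _ _)

  foldr-⊔-≤ : ∀ {k} → (∀ v → g v ≤ k) → ∀ xs → foldr (λ v acc → g v ⊔ acc) 0 xs ≤ k
  foldr-⊔-≤ g≤k []       = z≤n
  foldr-⊔-≤ g≤k (v ∷ xs) = ⊔-lub (g≤k v) (foldr-⊔-≤ g≤k xs)

module _ {n} {G : Graph n} where

  _++ʷ_ : ∀ {a b c i j} → Walk G a b i → Walk G b c j → Walk G a c (i + j)
  []      ++ʷ q = q
  (e ∷ p) ++ʷ q = e ∷ (p ++ʷ q)

  reverseʷ : ∀ {a b i} → Walk G a b i → Walk G b a i
  reverseʷ []              = []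
  reverseʷ {i = suc i} (e ∷ p) =
    subst (Walk G _ _) (+-comm i 1) (reverseʷ p ++ʷ (Graph.sym G e ∷ []))

  module _ {d : Fin n → Fin n → ℕ} (isd : IsShortestPathDistance G d) where

    shortestPath-sym : ∀ a b → d a b ≡ d b a
    shortestPath-sym a b = ≤-antisym (≤-reversed a b) (≤-reversed b a)
      where
      ≤-reversed : ∀ a b → d a b ≤ d b a
      ≤-reversed a b = proj₂ (isd a b) (d b a) (reverseʷ (proj₁ (isd b a)))

    shortestPath-triangle : ∀ a b c → d a c ≤ d a b + d b c
    shortestPath-triangle a b c =
      proj₂ (isd a c) (d a b + d b c) (proj₁ (isd a b) ++ʷ proj₁ (isd b c))

module FourPoint {n} (d : Fin n → Fin n → ℕ)
  (d-sym : ∀ a b → d a b ≡ d b a)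
  (d-triangle : ∀ a b c → d a c ≤ d a b + d b c) where

  d-triangle-pivot : ∀ a b c → d a b ≤ d c a + d c b
  d-triangle-pivot a b c = subst (λ t → d a b ≤ t + d c b) (d-sym a c) (d-triangle a c b)

  S₁≤S₂+2*d₁₂ : ∀ p q r s → S₁ d p q r s ≤ S₂ d p q r s + 2 * d p q
  S₁≤S₂+2*d₁₂ p q r s = begin
    d p q + d r s                      ≤⟨ +-monoʳ-≤ (d p q) (≤-trans (d-triangle-pivot r s p)
                                            (+-monoʳ-≤ (d p r) (d-triangle p q s))) ⟩
    d p q + (d p r + (d p q + d q s))  ≡⟨ regroup (d p q) (d p r) (d q s) ⟩
    (d p r + d q s) + 2 * d p q        ∎
    where
    open ≤-Reasoning
    regroup : ∀ a b c → a + (b + (a + c)) ≡ (b + c) + 2 * a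
    regroup = solve-∀

  S₂≤S₃+2*d₁₂ : ∀ p q r s → S₂ d p q r s ≤ S₃ d p q r s + 2 * d p q
  S₂≤S₃+2*d₁₂ p q r s = begin
    d p r + d q s                      ≤⟨ +-mono-≤ (d-triangle p q r) (d-triangle-pivot q s p) ⟩
    (d p q + d q r) + (d p q + d p s)  ≡⟨ regroup (d p q) (d q r) (d p s) ⟩
    (d p s + d q r) + 2 * d p q        ∎
    where
    open ≤-Reasoning
    regroup : ∀ a b c → (a + b) + (a + c) ≡ (c + b) + 2 * a
    regroup = solve-∀

  twiceδ≤2*d₁₂ : ∀ p q r s → twiceδ d p q r s ≤ 2 * d p q
  twiceδ≤2*d₁₂ p q r s = Balanced⇒spread≤ (record
    { first  = ≤-trans (S₁≤S₂+2*d₁₂ p q r s)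
                 (+-monoˡ-≤ (2 * d p q) (m≤m⊔n (S₂ d p q r s) (S₃ d p q r s)))
    ; second = ≤-trans (S₂≤S₃+2*d₁₂ p q r s) (+-monoˡ-≤ (2 * d p q) (m≤n⊔m (S₁ d p q r s) _))
    ; third  = ≤-trans (S₂≤S₃+2*d₁₂ p q s r) (+-monoˡ-≤ (2 * d p q) (m≤n⊔m (S₁ d p q r s) _))
    })

  S₁-swap-pairs : ∀ p q r s → S₁ d r s p q ≡ S₁ d p q r s
  S₁-swap-pairs p q r s = +-comm (d r s) (d p q)

  S₂-swap-pairs : ∀ p q r s → S₂ d r s p q ≡ S₂ d p q r s
  S₂-swap-pairs p q r s = cong₂ _+_ (d-sym r p) (d-sym s q)

  S₃-swap-pairs : ∀ p q r s → S₃ d r s p q ≡ S₃ d p q r s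
  S₃-swap-pairs p q r s = trans (+-comm (d r q) (d s p)) (cong₂ _+_ (d-sym s p) (d-sym r q))

  twiceδ-swap-pairs : ∀ p q r s → twiceδ d p q r s ≡ twiceδ d r s p q
  twiceδ-swap-pairs p q r s =
    sym (spread-cong (S₁-swap-pairs p q r s) (S₂-swap-pairs p q r s) (S₃-swap-pairs p q r s))

  twiceδ-swap₂₃ : ∀ p q r s → twiceδ d p q r s ≡ twiceδ d p r q s
  twiceδ-swap₂₃ p q r s =
    trans (spread-swap₁₂ (S₁ d p q r s) (S₂ d p q r s) (S₃ d p q r s))
      (cong (spread (S₂ d p q r s) (S₁ d p q r s)) (cong (d p s +_) (d-sym q r)))

  twiceδ-swap₃₄ : ∀ p q r s → twiceδ d p q r s ≡ twiceδ d p q s r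
  twiceδ-swap₃₄ p q r s =
    trans (spread-swap₂₃ (S₁ d p q r s) (S₂ d p q r s) (S₃ d p q r s))
      (cong (λ t → spread t (S₃ d p q r s) (S₂ d p q r s)) (cong (d p q +_) (d-sym r s)))

  twiceδ≤2*d₃₄ : ∀ p q r s → twiceδ d p q r s ≤ 2 * d r s
  twiceδ≤2*d₃₄ p q r s = ≤-trans (≤-reflexive (twiceδ-swap-pairs p q r s)) (twiceδ≤2*d₁₂ r s p q)

  twiceδ≤2*minPairs : ∀ p q r s → twiceδ d p q r s ≤ 2 * minPairs d d p q r s
  twiceδ≤2*minPairs p q r s =
    subst (twiceδ d p q r s ≤_) (sym (minPairs-homo d (2 *_) (*-monoʳ-≤ 2) d p q r s))
      (minPairs-glb d (λ a b → 2 * d a b) p q r s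
        (twiceδ≤2*d₁₂ p q r s)
        (via (twiceδ-swap₂₃ p q r s) (twiceδ≤2*d₁₂ p r q s))
        (via rotate (twiceδ≤2*d₁₂ p s q r))
        (via rotate (twiceδ≤2*d₃₄ p s q r))
        (via (twiceδ-swap₂₃ p q r s) (twiceδ≤2*d₃₄ p r q s))
        (twiceδ≤2*d₃₄ p q r s))
    where
    via : ∀ {a b c} → a ≡ b → b ≤ c → a ≤ c
    via a≡b b≤c = ≤-trans (≤-reflexive a≡b) b≤c
    rotate : twiceδ d p q r s ≡ twiceδ d p s q r
    rotate = trans (twiceδ-swap₃₄ p q r s) (twiceδ-swap₂₃ p q s r)

  S₁≤S₂⊔S₃+d₁₂ : ∀ p q r s → S₁ d p q r s ≤ (S₂ d p q r s ⊔ S₃ d p q r s) + d p q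
  S₁≤S₂⊔S₃+d₁₂ p q r s =
    2*x≤y+z+2*t⇒x≤y⊔z+t (S₁ d p q r s) (S₂ d p q r s) (S₃ d p q r s) (d p q) (begin
      2 * (d p q + d r s)
        ≡⟨ regroup₁ (d p q) (d r s) ⟩
      (d r s + d r s) + 2 * d p q
        ≤⟨ +-monoˡ-≤ (2 * d p q) (+-mono-≤ (d-triangle-pivot r s p) (d-triangle-pivot r s q)) ⟩
      ((d p r + d p s) + (d q r + d q s)) + 2 * d p q
        ≡⟨ regroup₂ (d p r) (d p s) (d q r) (d q s) (d p q) ⟩
      ((d p r + d q s) + (d p s + d q r)) + 2 * d p q  ∎)
    where
    open ≤-Reasoning
    regroup₁ : ∀ a b → 2 * (a + b) ≡ (b + b) + 2 * a
    regroup₁ = solve-∀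
    regroup₂ : ∀ a b c e t → ((a + b) + (c + e)) + 2 * t ≡ ((a + e) + (b + c)) + 2 * t
    regroup₂ = solve-∀

  S₁≤S₂⊔S₃+d₁₂⊓d₃₄ : ∀ p q r s → S₁ d p q r s ≤ (S₂ d p q r s ⊔ S₃ d p q r s) + (d p q ⊓ d r s)
  S₁≤S₂⊔S₃+d₁₂⊓d₃₄ p q r s = +-⊓-glb {y = S₂ d p q r s ⊔ S₃ d p q r s} (S₁≤S₂⊔S₃+d₁₂ p q r s)
    (subst₂ (λ a b → a ≤ b + d r s) (S₁-swap-pairs p q r s)
      (cong₂ _⊔_ (S₂-swap-pairs p q r s) (S₃-swap-pairs p q r s)) (S₁≤S₂⊔S₃+d₁₂ r s p q))

module Dominators {n} (d : Fin n → Fin n → ℕ)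
  (d-sym : ∀ a b → d a b ≡ d b a)
  (d-triangle : ∀ a b c → d a c ≤ d a b + d b c)
  (Dom : Fin n → Fin n) where

  open FourPoint d d-sym d-triangle

  κ : Fin n → ℕ
  κ = kOf d Dom

  d[Dom,-]≤κ : ∀ a → d (Dom a) a ≤ κ (Dom a)
  d[Dom,-]≤κ a = subst (_≤ κ (Dom a)) (own-term a) (foldr-⊔-≥ _ (∈-allFin a))
    where
    own-term : ∀ a → (if does (Dom a ≟ Dom a) then d (Dom a) a else 0) ≡ d (Dom a) a
    own-term a with Dom a ≟ Dom a
    ... | yes _   = refl
    ... | no ≢Dom = contradiction refl ≢Dom

  d[-,Dom]≤κ : ∀ a → d a (Dom a) ≤ κ (Dom a)
  d[-,Dom]≤κ a = subst (_≤ κ (Dom a)) (d-sym (Dom a) a) (d[Dom,-]≤κ a)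

  d-detour : ∀ {a a′ b b′ K L} → d a′ a ≤ K → d b b′ ≤ L → d a′ b′ ≤ d a b + (K + L)
  d-detour {a} {a′} {b} {b′} {K} {L} a′a≤K bb′≤L = begin
    d a′ b′                ≤⟨ d-triangle a′ a b′ ⟩
    d a′ a + d a b′        ≤⟨ +-mono-≤ a′a≤K (≤-trans (d-triangle a b b′)
                                                   (+-monoʳ-≤ (d a b) bb′≤L)) ⟩
    K + (d a b + L)        ≡⟨ regroup K (d a b) L ⟩
    d a b + (K + L)        ∎
    where
    open ≤-Reasoning
    regroup : ∀ K x L → K + (x + L) ≡ x + (K + L)
    regroup = solve-∀

  dist-Close : ∀ a b → Close (κ (Dom a) + κ (Dom b)) (d (Dom a) (Dom b)) (d a b)
  dist-Close a b = d-detour (d[Dom,-]≤κ a) (d[-,Dom]≤κ b) , d-detour (d[-,Dom]≤κ a) (d[Dom,-]≤κ b)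

  d≤κ+κ+d[Dom,Dom] : ∀ a b → d a b ≤ κ (Dom a) + κ (Dom b) + d (Dom a) (Dom b)
  d≤κ+κ+d[Dom,Dom] a b = ≤-trans (proj₂ (dist-Close a b))
    (≤-reflexive (+-comm (d (Dom a) (Dom b)) (κ (Dom a) + κ (Dom b))))

  twiceδ≤2*minPairs-Dom : ∀ p q r s →
    twiceδ d p q r s ≤ 2 * minPairs d (λ a b → κ a + κ b + d a b) (Dom p) (Dom q) (Dom r) (Dom s)
  twiceδ≤2*minPairs-Dom p q r s =
    ≤-trans (twiceδ≤2*minPairs p q r s) (*-monoʳ-≤ 2 (minPairs-mono d d≤κ+κ+d[Dom,Dom] p q r s))

  S₁≤S₂⊔S₃+min-Dom : ∀ p q r s →
    S₁ d p q r s ≤ (S₂ d p q r s ⊔ S₃ d p q r s)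
      + ((κ (Dom p) + κ (Dom q) + d (Dom p) (Dom q)) ⊓ (κ (Dom r) + κ (Dom s) + d (Dom r) (Dom s)))
  S₁≤S₂⊔S₃+min-Dom p q r s = ≤-trans (S₁≤S₂⊔S₃+d₁₂⊓d₃₄ p q r s)
    (+-monoʳ-≤ (S₂ d p q r s ⊔ S₃ d p q r s)
      (⊓-mono-≤ (d≤κ+κ+d[Dom,Dom] p q) (d≤κ+κ+d[Dom,Dom] r s)))

  twiceδ≤2*κ+min-Dom : ∀ p q r s →
    let u = Dom p ; v = Dom q ; x = Dom r ; y = Dom s in
    S₂ d u v x y ≤ S₁ d u v x y → S₃ d u v x y ≤ S₁ d u v x y →
    twiceδ d p q r s ≤ 2 * (κ u + κ v + κ x + κ y) + (d u v ⊓ d x y)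
  twiceδ≤2*κ+min-Dom p q r s S₂≤S₁ S₃≤S₁ = Balanced⇒spread≤ (Balanced-perturb
    (regroup-Close (regroup₁ (κ (Dom p)) (κ (Dom q)) (κ (Dom r)) (κ (Dom s)))
      (Close-+ (dist-Close p q) (dist-Close r s)))
    (regroup-Close (regroup₂ (κ (Dom p)) (κ (Dom q)) (κ (Dom r)) (κ (Dom s)))
      (Close-+ (dist-Close p r) (dist-Close q s)))
    (regroup-Close (regroup₃ (κ (Dom p)) (κ (Dom q)) (κ (Dom r)) (κ (Dom s)))
      (Close-+ (dist-Close p s) (dist-Close q r)))
    (Balanced-fromMax S₂≤S₁ S₃≤S₁ (S₁≤S₂⊔S₃+d₁₂⊓d₃₄ (Dom p) (Dom q) (Dom r) (Dom s))))
    where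
    regroup-Close : ∀ {K L a b} → K ≡ L → Close K a b → Close L a b
    regroup-Close refl c = c
    regroup₁ : ∀ a b c e → (a + b) + (c + e) ≡ a + b + c + e
    regroup₁ = solve-∀
    regroup₂ : ∀ a b c e → (a + c) + (b + e) ≡ a + b + c + e
    regroup₂ = solve-∀
    regroup₃ : ∀ a b c e → (a + e) + (b + c) ≡ a + b + c + e
    regroup₃ = solve-∀

  module _ {k} (d[-,Dom]≤k : ∀ w → d w (Dom w) ≤ k) where

    κ≤k : ∀ a → κ a ≤ k
    κ≤k a = foldr-⊔-≤ _ own-term≤k (allFin n)
      where
      own-term≤k : ∀ w → (if does (Dom w ≟ a) then d a w else 0) ≤ k
      own-term≤k w with Dom w ≟ a
      ... | yes Dom≡a =
        subst (λ c → d c w ≤ k) Dom≡a (subst (_≤ k) (d-sym w (Dom w)) (d[-,Dom]≤k w))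
      ... | no _      = z≤n

    κ+κ+d≤2*k+d : ∀ a b → κ a + κ b + d a b ≤ 2 * k + d a b
    κ+κ+d≤2*k+d a b =
      +-monoˡ-≤ (d a b) (≤-trans (+-mono-≤ (κ≤k a) (κ≤k b)) (≤-reflexive (k+k≡2*k k)))
      where
      k+k≡2*k : ∀ k → k + k ≡ 2 * k
      k+k≡2*k = solve-∀

    minPairs-κ≤2*k+minPairs : ∀ u v x y →
      minPairs d (λ a b → κ a + κ b + d a b) u v x y ≤ 2 * k + minPairs d d u v x y
    minPairs-κ≤2*k+minPairs u v x y =
      subst (minPairs d (λ a b → κ a + κ b + d a b) u v x y ≤_)
        (sym (minPairs-homo d (2 * k +_) (+-monoʳ-≤ (2 * k)) d u v x y))
        (minPairs-mono d κ+κ+d≤2*k+d u v x y)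

    κ-sum≤4*k : ∀ u v x y → κ u + κ v + κ x + κ y ≤ 4 * k
    κ-sum≤4*k u v x y = ≤-trans (+-mono-≤ (+-mono-≤ (+-mono-≤ (κ≤k u) (κ≤k v)) (κ≤k x)) (κ≤k y))
      (≤-reflexive (four-k k))
      where
      four-k : ∀ k → k + k + k + k ≡ 4 * k
      four-k = solve-∀

    ⊓-κ≤2*k+⊓ : ∀ u v x y →
      (κ u + κ v + d u v) ⊓ (κ x + κ y + d x y) ≤ 2 * k + (d u v ⊓ d x y)
    ⊓-κ≤2*k+⊓ u v x y =
      subst ((κ u + κ v + d u v) ⊓ (κ x + κ y + d x y) ≤_)
        (sym (+-distribˡ-⊓ (2 * k) (d u v) (d x y)))
        (⊓-mono-≤ (κ+κ+d≤2*k+d u v) (κ+κ+d≤2*k+d x y))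

lemma3 : ∀ {n} (G : Graph n) → Connected G →
    (d : Fin n → Fin n → ℕ) → IsShortestPathDistance G d →
    (k : ℕ) (D : Fin n → Set) (Dom : Fin n → Fin n) →
    (∀ w → D (Dom w)) → (∀ w → d w (Dom w) ≤ k) →
    (u v x y : Fin n) → D u → D v → D x → D y →
    (u' v' x' y' : Fin n) →
    Dom u' ≡ u → Dom v' ≡ v → Dom x' ≡ x → Dom y' ≡ y →
    let kk = kOf d Dom in
    (twiceδ d u' v' x' y'
        ≤ 2 * minPairs d (λ a b → kk a + kk b + d a b) u v x y
      × 2 * minPairs d (λ a b → kk a + kk b + d a b) u v x y
        ≤ 2 * (2 * k + minPairs d d u v x y))
    ×
    (S₂ d u v x y ≤ S₁ d u v x y → S₃ d u v x y ≤ S₁ d u v x y →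
      (twiceδ d u' v' x' y'
          ≤ 2 * (kk u + kk v + kk x + kk y) + (d u v ⊓ d x y)
        × 2 * (kk u + kk v + kk x + kk y) + (d u v ⊓ d x y)
          ≤ 2 * (4 * k) + (d u v ⊓ d x y))
      ×
      (S₁ d u' v' x' y'
          ≤ (S₂ d u' v' x' y' ⊔ S₃ d u' v' x' y')
            + ((kk u + kk v + d u v) ⊓ (kk x + kk y + d x y))
        × ((kk u + kk v + d u v) ⊓ (kk x + kk y + d x y))
          ≤ 2 * k + (d u v ⊓ d x y)))
lemma3 G _ d isd k _ Dom _ d[-,Dom]≤k u v x y _ _ _ _ p q r s refl refl refl refl =
  ( twiceδ≤2*minPairs-Dom p q r s
  , *-monoʳ-≤ 2 (minPairs-κ≤2*k+minPairs d[-,Dom]≤k u v x y) )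
  , λ S₂≤S₁ S₃≤S₁ →
    ( twiceδ≤2*κ+min-Dom p q r s S₂≤S₁ S₃≤S₁
    , +-monoˡ-≤ (d u v ⊓ d x y) (*-monoʳ-≤ 2 (κ-sum≤4*k d[-,Dom]≤k u v x y)) )
  , ( S₁≤S₂⊔S₃+min-Dom p q r s
    , ⊓-κ≤2*k+⊓ d[-,Dom]≤k u v x y )
  where
  open Dominators d (shortestPath-sym isd) (shortestPath-triangle isd) Dom
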